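{- For a Petri net $\mathsf P$, the face map $d_0:\mathbf X_1\to\mathbf X_0$, which sends a process to its final state, is a fibration of groupoids.
   Context: A Petri net $\mathsf P$ is a diagram of finite sets $S\leftarrow I\to T\leftarrow O\to S$. A graph is a diagram of finite sets $A\leftarrow I_G\to N\leftarrow O_G\to A$ with injective outer maps; etale maps are morphisms of such diagrams whose two middle squares are pullbacks; acyclic means no directed cycles of nodes. The out-boundary of a graph is the set of edges not in the image of $I_G\to A$. $\mathbf X_1$ is the groupoid of processes (etale maps $\mathsf G\to\mathsf P$ from acyclic graphs, morphisms being graph isomorphisms commuting with the maps to $\mathsf P$); $\mathbf X_0$ is the groupoid of states (maps $M\to S$ of finite sets, morphisms bijections over $S$); $d_0$ restricts a process to its out-boundary. A functor of groupoids $p:X\to B$ is a fibration if for every $x\in X$ and isomorphism $\beta:p(x)\to b$ in $B$ there is an arrow $\phi:x\to x'$ with $p(\phi)=\beta$. -}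

module Defs where

open import Data.Nat using (ℕ; zero; suc)
open import Data.Fin using (Fin; zero; suc; _≟_)
open import Data.Bool using (Bool; true; false; not; _∨_)
open import Data.Vec using (Vec; lookup; tabulate)
open import Data.Product using (Σ; _×_; _,_)
open import Function using (_∘_)
open import Function.Bundles using (_↔_; Inverse)
open import Function.Definitions using (Injective)
open import Relation.Nullary using (¬_)
open import Relation.Nullary.Decidable using (⌊_⌋)
open import Relation.Binary.PropositionalEquality using (_≡_; subst; sym)
open import Relation.Binary.Construct.Closure.Transitive using (TransClosure)

-- Petri nets:  S ← I → T ← O → S   (finite sets coded as Fin _)

record PetriNet : Set where
  field
    nS nT nI nO : ℕ
    iS : Fin nI → Fin nS
    iT : Fin nI → Fin nT
    oT : Fin nO → Fin nT
    oS : Fin nO → Fin nS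

record Graph : Set where
  field
    nA nN nI nO : ℕ
    iA : Fin nI → Fin nA
    iN : Fin nI → Fin nN
    oN : Fin nO → Fin nN
    oA : Fin nO → Fin nA
    iA-inj : Injective _≡_ _≡_ iA
    oA-inj : Injective _≡_ _≡_ oA

-- A commutative square  X --g--> Y, X --h--> Z, Y --k--> W, Z --l--> W
-- (k ∘ g = l ∘ h assumed separately) is a pullback in Set.
IsPullback : {x y z w : ℕ} (g : Fin x → Fin y) (h : Fin x → Fin z)
             (k : Fin y → Fin w) (l : Fin z → Fin w) → Set
IsPullback {x} g h k l =
  ((a : _) (b : _) → k a ≡ l b → Σ (Fin x) λ c → g c ≡ a × h c ≡ b)
  × ((c c′ : Fin x) → g c ≡ g c′ → h c ≡ h c′ → c ≡ c′)

record Etale (G : Graph) (P : PetriNet) : Set where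
  open Graph G
  open PetriNet P renaming (nI to pI; nO to pO)
  field
    fA : Fin nA → Fin nS
    fI : Fin nI → Fin pI
    fN : Fin nN → Fin nT
    fO : Fin nO → Fin pO
    comm-iS : ∀ c → fA (iA c) ≡ iS (fI c)
    comm-iT : ∀ c → fN (iN c) ≡ iT (fI c)
    comm-oT : ∀ c → fN (oN c) ≡ oT (fO c)
    comm-oS : ∀ c → fA (oA c) ≡ oS (fO c)
    pb-I : IsPullback iN fI fN iT
    pb-O : IsPullback oN fO fN oT

Step : (G : Graph) → Fin (Graph.nN G) → Fin (Graph.nN G) → Set
Step G n m = Σ (Fin nO) λ o → Σ (Fin nI) λ i → oN o ≡ n × iN i ≡ m × oA o ≡ iA i
  where open Graph G

Acyclic : Graph → Set
Acyclic G = ∀ n → ¬ TransClosure (Step G) n n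

-- Processes (objects of X₁)
record Process (P : PetriNet) : Set where
  field
    graph   : Graph
    etale   : Etale graph P
    acyclic : Acyclic graph

record ProcIso {P : PetriNet} (x y : Process P) : Set where
  module G = Graph (Process.graph x)
  module H = Graph (Process.graph y)
  module F = Etale (Process.etale x)
  module K = Etale (Process.etale y)
  field
    eA : Fin G.nA ↔ Fin H.nA
    eI : Fin G.nI ↔ Fin H.nI
    eN : Fin G.nN ↔ Fin H.nN
    eO : Fin G.nO ↔ Fin H.nO
    c-iA : ∀ c → H.iA (Inverse.to eI c) ≡ Inverse.to eA (G.iA c)
    c-iN : ∀ c → H.iN (Inverse.to eI c) ≡ Inverse.to eN (G.iN c)
    c-oN : ∀ c → H.oN (Inverse.to eO c) ≡ Inverse.to eN (G.oN c)
    c-oA : ∀ c → H.oA (Inverse.to eO c) ≡ Inverse.to eA (G.oA c)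
    o-A : ∀ a → K.fA (Inverse.to eA a) ≡ F.fA a
    o-I : ∀ c → K.fI (Inverse.to eI c) ≡ F.fI c
    o-N : ∀ n → K.fN (Inverse.to eN n) ≡ F.fN n
    o-O : ∀ c → K.fO (Inverse.to eO c) ≡ F.fO c

-- States (objects of X₀): a map M → S with M = Fin size, the map given
-- as a vector of labels.

record State (P : PetriNet) : Set where
  constructor state
  field
    size   : ℕ
    labels : Vec (Fin (PetriNet.nS P)) size

record StateIso {P : PetriNet} (m m′ : State P) : Set where
  field
    bij  : Fin (State.size m) ↔ Fin (State.size m′)
    over : ∀ j → lookup (State.labels m′) (Inverse.to bij j) ≡ lookup (State.labels m) j

inImage : {k n : ℕ} → (Fin k → Fin n) → Fin n → Bool
inImage {zero}  f a = false
inImage {suc k} f a = ⌊ f zero ≟ a ⌋ ∨ inImage (f ∘ suc) a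

countB : Bool → ℕ → ℕ
countB true  k = suc k
countB false k = k

count : {n : ℕ} → (Fin n → Bool) → ℕ
count {zero}  p = 0
count {suc n} p = countB (p zero) (count (p ∘ suc))

enumB : {k n : ℕ} (b : Bool) → (Fin k → Fin n) → Fin (countB b k) → Fin (suc n)
enumB true  e zero    = zero
enumB true  e (suc j) = suc (e j)
enumB false e j       = suc (e j)

enum : {n : ℕ} (p : Fin n → Bool) → Fin (count p) → Fin n
enum {zero}  p ()
enum {suc n} p = enumB (p zero) (enum (p ∘ suc))

module _ {P : PetriNet} (x : Process P) where
  open Graph (Process.graph x)
  open Etale (Process.etale x)

  isOut : Fin nA → Bool
  isOut a = not (inImage iA a)

  -- the out-boundary, enumerated in increasing order
  outSize : ℕ
  outSize = count isOut

  outEdge : Fin outSize → Fin nA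
  outEdge = enum isOut

  d₀ : State P
  d₀ = state outSize (tabulate (fA ∘ outEdge))

-- d₀ on morphisms restricts the edge bijection to out-boundaries; the
-- statement "d₀ φ = β" says β agrees with this restriction.
RestrictsTo : {P : PetriNet} {x y : Process P} → ProcIso x y →
              StateIso (d₀ x) (d₀ y) → Set
RestrictsTo {x = x} {y} φ β =
  ∀ j → outEdge y (Inverse.to (StateIso.bij β) j)
        ≡ Inverse.to (ProcIso.eA φ) (outEdge x j)

D₀IsFibration : PetriNet → Set
D₀IsFibration P =
  (x : Process P) (b : State P) (β : StateIso (d₀ x) b) →
  Σ (Process P) λ x′ → Σ (d₀ x′ ≡ b) λ e → Σ (ProcIso x x′) λ φ →
    RestrictsTo φ (subst (StateIso (d₀ x)) (sym e) β)

-- Relabelling the edges of a process along any bijection yields an isomorphic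
-- process. Given β from the final state of x to a state b, extend the bijection
-- of β on the out-boundary by the identity on the remaining edges. This
-- permutation of the edges preserves the out-boundary, and relabelling x along
-- it rearranges the increasing enumeration of the out-boundary so that the
-- final state becomes b on the nose, with β the restriction of the relabelling.

module Submission where

open import Defs
open import Data.Nat using (ℕ; zero; suc; pred)
open import Data.Fin using (Fin; zero; suc; _≟_; cast)
open import Data.Fin.Permutation using (↔⇒≡)
open import Data.Fin.Properties using (cast-is-id)
open import Data.Bool using (Bool; true; false; not)
open import Data.Bool.Properties using (not-injective)
open import Data.Sum using (_⊎_; inj₁; inj₂; [_,_]; map₁; map₂)
open import Data.Sum.Function.Propositional using (_⊎-↔_)
open import Data.Product using (_,_)
open import Data.Vec using (Vec; lookup; tabulate)
open import Data.Vec.Properties using (lookup∘tabulate; tabulate∘lookup; tabulate-cong)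
open import Function using (_∘_; id; const)
open import Function.Bundles using (_↔_; Inverse; Injection; mk↔ₛ′)
open import Function.Definitions using (Injective)
open import Function.Properties.Inverse using (↔-refl; ↔-sym; ↔-trans; ↔⇒↣)
open import Relation.Nullary using (yes; no; contradiction)
open import Relation.Binary.PropositionalEquality hiding ([_])
open import Relation.Binary.Construct.Closure.Transitive using (TransClosure; _∷_) renaming ([_] to [_]⁺)

open Inverse using (to; from; strictlyInverseˡ; strictlyInverseʳ)

enum-satisfies : {n : ℕ} (p : Fin n → Bool) (j : Fin (count p)) → p (enum p j) ≡ true
enum-satisfies {suc n} p j with p zero in eq
enum-satisfies {suc n} p zero    | true  = eq
enum-satisfies {suc n} p (suc j) | true  = enum-satisfies (p ∘ suc) j
enum-satisfies {suc n} p j       | false = enum-satisfies (p ∘ suc) j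

splitB : {n k l : ℕ} (b : Bool) → (Fin n → Fin k ⊎ Fin l) →
         Fin (suc n) → Fin (countB b k) ⊎ Fin (countB (not b) l)
splitB true  s zero    = inj₁ zero
splitB false s zero    = inj₂ zero
splitB true  s (suc a) = map₁ suc (s a)
splitB false s (suc a) = map₂ suc (s a)

split : {n : ℕ} (p : Fin n → Bool) → Fin n → Fin (count p) ⊎ Fin (count (not ∘ p))
split {suc n} p = splitB (p zero) (split (p ∘ suc))

join : {n : ℕ} (p : Fin n → Bool) → Fin (count p) ⊎ Fin (count (not ∘ p)) → Fin n
join p = [ enum p , enum (not ∘ p) ]

joinB-splitB : {n k l : ℕ} (b : Bool) (s : Fin n → Fin k ⊎ Fin l)
               (e₁ : Fin k → Fin n) (e₂ : Fin l → Fin n) →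
               (∀ a → [ e₁ , e₂ ] (s a) ≡ a) →
               ∀ a → [ enumB b e₁ , enumB (not b) e₂ ] (splitB b s a) ≡ a
joinB-splitB true  s e₁ e₂ h zero = refl
joinB-splitB false s e₁ e₂ h zero = refl
joinB-splitB true  s e₁ e₂ h (suc a) with s a | h a
... | inj₁ j | q = cong suc q
... | inj₂ j | q = cong suc q
joinB-splitB false s e₁ e₂ h (suc a) with s a | h a
... | inj₁ j | q = cong suc q
... | inj₂ j | q = cong suc q

join-split : {n : ℕ} (p : Fin n → Bool) (a : Fin n) → join p (split p a) ≡ a
join-split {suc n} p =
  joinB-splitB (p zero) (split (p ∘ suc)) (enum (p ∘ suc)) (enum (not ∘ p ∘ suc)) (join-split (p ∘ suc))

splitB-joinB : {n k l : ℕ} (b : Bool) (s : Fin n → Fin k ⊎ Fin l)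
               (e₁ : Fin k → Fin n) (e₂ : Fin l → Fin n) →
               (∀ c → s ([ e₁ , e₂ ] c) ≡ c) →
               ∀ c → splitB b s ([ enumB b e₁ , enumB (not b) e₂ ] c) ≡ c
splitB-joinB true  s e₁ e₂ h (inj₁ zero)    = refl
splitB-joinB true  s e₁ e₂ h (inj₁ (suc j)) = cong (map₁ suc) (h (inj₁ j))
splitB-joinB true  s e₁ e₂ h (inj₂ j)       = cong (map₁ suc) (h (inj₂ j))
splitB-joinB false s e₁ e₂ h (inj₁ j)       = cong (map₂ suc) (h (inj₁ j))
splitB-joinB false s e₁ e₂ h (inj₂ zero)    = refl
splitB-joinB false s e₁ e₂ h (inj₂ (suc j)) = cong (map₂ suc) (h (inj₂ j))

split-join : {n : ℕ} (p : Fin n → Bool) (c : Fin (count p) ⊎ Fin (count (not ∘ p))) →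
             split p (join p c) ≡ c
split-join {zero}  p (inj₁ ())
split-join {zero}  p (inj₂ ())
split-join {suc n} p =
  splitB-joinB (p zero) (split (p ∘ suc)) (enum (p ∘ suc)) (enum (not ∘ p ∘ suc)) (split-join (p ∘ suc))

split-↔ : {n : ℕ} (p : Fin n → Bool) → Fin n ↔ (Fin (count p) ⊎ Fin (count (not ∘ p)))
split-↔ p = mk↔ₛ′ (split p) (join p) (split-join p) (join-split p)

isInj₁ : {A B : Set} → A ⊎ B → Bool
isInj₁ = [ const true , const false ]

satisfies-join : {n : ℕ} (p : Fin n → Bool) (c : Fin (count p) ⊎ Fin (count (not ∘ p))) →
                 p (join p c) ≡ isInj₁ c
satisfies-join p (inj₁ j) = enum-satisfies p j
satisfies-join p (inj₂ j) = not-injective (enum-satisfies (not ∘ p) j)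

count-cong : {n : ℕ} (p q : Fin n → Bool) → (∀ a → p a ≡ q a) → count p ≡ count q
count-cong {zero}  p q h = refl
count-cong {suc n} p q h with p zero | q zero | h zero
... | true  | true  | refl = cong suc (count-cong (p ∘ suc) (q ∘ suc) (h ∘ suc))
... | false | false | refl = count-cong (p ∘ suc) (q ∘ suc) (h ∘ suc)

enum-cong : {n : ℕ} (p q : Fin n → Bool) → (∀ a → p a ≡ q a) →
            (c : count p ≡ count q) (j : Fin (count p)) → enum q (cast c j) ≡ enum p j
enum-cong {suc n} p q h c j with p zero | q zero | h zero
enum-cong {suc n} p q h c zero    | true  | true  | refl = refl
enum-cong {suc n} p q h c (suc j) | true  | true  | refl =
  cong suc (enum-cong (p ∘ suc) (q ∘ suc) (h ∘ suc) (cong pred c) j)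
enum-cong {suc n} p q h c j       | false | false | refl =
  cong suc (enum-cong (p ∘ suc) (q ∘ suc) (h ∘ suc) c j)

extend : {n : ℕ} (p : Fin n → Bool) → Fin (count p) ↔ Fin (count p) → Fin n ↔ Fin n
extend p π = ↔-trans (split-↔ p) (↔-trans (π ⊎-↔ ↔-refl) (↔-sym (split-↔ p)))

extend-enum : {n : ℕ} (p : Fin n → Bool) (π : Fin (count p) ↔ Fin (count p)) (j : Fin (count p)) →
              to (extend p π) (enum p j) ≡ enum p (to π j)
extend-enum p π j = cong (join p ∘ map₁ (to π)) (split-join p (inj₁ j))

extend⁻¹-enum : {n : ℕ} (p : Fin n → Bool) (π : Fin (count p) ↔ Fin (count p)) (j : Fin (count p)) →
                from (extend p π) (enum p j) ≡ enum p (from π j)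
extend⁻¹-enum p π j = cong (join p ∘ map₁ (from π)) (split-join p (inj₁ j))

extend⁻¹-preserves : {n : ℕ} (p : Fin n → Bool) (π : Fin (count p) ↔ Fin (count p)) (a : Fin n) →
                     p (from (extend p π) a) ≡ p a
extend⁻¹-preserves p π a = begin
  p (join p (map₁ (from π) (split p a))) ≡⟨ satisfies-join p (map₁ (from π) (split p a)) ⟩
  isInj₁ (map₁ (from π) (split p a))     ≡⟨ isInj₁-map₁ (split p a) ⟩
  isInj₁ (split p a)                     ≡⟨ satisfies-join p (split p a) ⟨
  p (join p (split p a))                 ≡⟨ cong p (join-split p a) ⟩
  p a                                    ∎
  where
  open ≡-Reasoning
  isInj₁-map₁ : (c : Fin (count p) ⊎ Fin (count (not ∘ p))) → isInj₁ (map₁ (from π) c) ≡ isInj₁ c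
  isInj₁-map₁ (inj₁ _) = refl
  isInj₁-map₁ (inj₂ _) = refl

inImage-↔ : {k n m : ℕ} (e : Fin n ↔ Fin m) (f : Fin k → Fin n) (a : Fin m) →
            inImage (to e ∘ f) a ≡ inImage f (from e a)
inImage-↔ {zero}  e f a = refl
inImage-↔ {suc k} e f a with to e (f zero) ≟ a | f zero ≟ from e a
... | yes _  | yes _  = refl
... | no _   | no _   = inImage-↔ e (f ∘ suc) a
... | yes eq | no neq = contradiction (trans (sym (strictlyInverseʳ e _)) (cong (from e) eq)) neq
... | no neq | yes eq = contradiction (trans (cong (to e) eq) (strictlyInverseˡ e a)) neq

acyclic-reflect : {G H : Graph} (f : Fin (Graph.nN H) → Fin (Graph.nN G)) →
                  (∀ {n m} → Step H n m → Step G (f n) (f m)) → Acyclic G → Acyclic H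
acyclic-reflect {G} {H} f step acyclic n = acyclic (f n) ∘ closure
  where
  closure : ∀ {n m} → TransClosure (Step H) n m → TransClosure (Step G) (f n) (f m)
  closure [ s ]⁺   = [ step s ]⁺
  closure (s ∷ ss) = step s ∷ closure ss

module _ {P : PetriNet} (x : Process P) {m : ℕ} (e : Fin (Graph.nA (Process.graph x)) ↔ Fin m) where
  open Graph (Process.graph x)
  open Etale (Process.etale x)

  private
    to-injective : Injective _≡_ _≡_ (to e)
    to-injective = Injection.injective (↔⇒↣ e)

    relabelledGraph : Graph
    relabelledGraph = record
      { nA = m ; nN = nN ; nI = nI ; nO = nO
      ; iA = to e ∘ iA ; iN = iN ; oN = oN ; oA = to e ∘ oA
      ; iA-inj = iA-inj ∘ to-injective
      ; oA-inj = oA-inj ∘ to-injective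
      }

  relabelEdges : Process P
  relabelEdges = record
    { graph   = relabelledGraph
    ; etale   = record
      { fA = fA ∘ from e ; fI = fI ; fN = fN ; fO = fO
      ; comm-iS = λ c → trans (cong fA (strictlyInverseʳ e (iA c))) (comm-iS c)
      ; comm-iT = comm-iT
      ; comm-oT = comm-oT
      ; comm-oS = λ c → trans (cong fA (strictlyInverseʳ e (oA c))) (comm-oS c)
      ; pb-I = pb-I
      ; pb-O = pb-O
      }
    ; acyclic = acyclic-reflect {Process.graph x} {relabelledGraph} id
                  (λ (o , i , o↦n , i↦n′ , o≡i) → o , i , o↦n , i↦n′ , to-injective o≡i)
                  (Process.acyclic x)
    }

  relabelEdges-iso : ProcIso x relabelEdges
  relabelEdges-iso = record
    { eA = e ; eI = ↔-refl ; eN = ↔-refl ; eO = ↔-refl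
    ; c-iA = λ _ → refl ; c-iN = λ _ → refl ; c-oN = λ _ → refl ; c-oA = λ _ → refl
    ; o-A = λ a → cong fA (strictlyInverseʳ e a)
    ; o-I = λ _ → refl ; o-N = λ _ → refl ; o-O = λ _ → refl
    }

  isOut-relabelEdges : (a : Fin m) → isOut relabelEdges a ≡ isOut x (from e a)
  isOut-relabelEdges a = cong not (inImage-↔ e iA a)

state-≡ : {P : PetriNet} {n m : ℕ} (c : m ≡ n) (v : Vec (Fin (PetriNet.nS P)) n) (w : Vec _ m) →
          (∀ j → lookup v (cast c j) ≡ lookup w j) → state {P} n v ≡ state m w
state-≡ {n = n} refl v w v≗w = cong (state n) (begin
  v                   ≡⟨ tabulate∘lookup v ⟨
  tabulate (lookup v) ≡⟨ tabulate-cong (λ j → trans (cong (lookup v) (sym (cast-is-id refl j))) (v≗w j)) ⟩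
  tabulate (lookup w) ≡⟨ tabulate∘lookup w ⟩
  w                   ∎)
  where open ≡-Reasoning

lookup-from : {P : PetriNet} {m m′ : State P} (β : StateIso m m′) (j : Fin (State.size m′)) →
              lookup (State.labels m′) j ≡ lookup (State.labels m) (from (StateIso.bij β) j)
lookup-from {m′ = m′} β j =
  trans (cong (lookup (State.labels m′)) (sym (strictlyInverseˡ (StateIso.bij β) j))) (StateIso.over β _)

to-subst-StateIso : {P : PetriNet} {m₀ m m′ : State P} (e : m ≡ m′) (β : StateIso m₀ m′)
                    (j : Fin (State.size m₀)) →
                    to (StateIso.bij (subst (StateIso m₀) (sym e) β)) j
                      ≡ cast (sym (cong State.size e)) (to (StateIso.bij β) j)
to-subst-StateIso refl β j = sym (cast-is-id refl _)

module _ {P : PetriNet} (x : Process P) (π : Fin (outSize x) ↔ Fin (outSize x)) where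
  open Etale (Process.etale x) using (fA)

  permuteOut : Process P
  permuteOut = relabelEdges x (extend (isOut x) π)

  permuteOut-iso : ProcIso x permuteOut
  permuteOut-iso = relabelEdges-iso x (extend (isOut x) π)

  isOut-permuteOut : (a : Fin (Graph.nA (Process.graph x))) → isOut x a ≡ isOut permuteOut a
  isOut-permuteOut a =
    sym (trans (isOut-relabelEdges x (extend (isOut x) π) a) (extend⁻¹-preserves (isOut x) π a))

  outSize-permuteOut : outSize x ≡ outSize permuteOut
  outSize-permuteOut = count-cong (isOut x) (isOut permuteOut) isOut-permuteOut

  outEdge-permuteOut : (c : outSize x ≡ outSize permuteOut) (j : Fin (outSize x)) →
                       outEdge permuteOut (cast c j) ≡ outEdge x j
  outEdge-permuteOut = enum-cong (isOut x) (isOut permuteOut) isOut-permuteOut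

  d₀-permuteOut : d₀ permuteOut ≡ state (outSize x) (tabulate (lookup (State.labels (d₀ x)) ∘ from π))
  d₀-permuteOut = state-≡ outSize-permuteOut _ _ λ j → begin
    lookup (State.labels (d₀ permuteOut)) (cast outSize-permuteOut j)
      ≡⟨ lookup∘tabulate (fA ∘ from (extend (isOut x) π) ∘ outEdge permuteOut) _ ⟩
    fA (from (extend (isOut x) π) (outEdge permuteOut (cast outSize-permuteOut j)))
      ≡⟨ cong (fA ∘ from (extend (isOut x) π)) (outEdge-permuteOut outSize-permuteOut j) ⟩
    fA (from (extend (isOut x) π) (outEdge x j))
      ≡⟨ cong fA (extend⁻¹-enum (isOut x) π j) ⟩
    fA (outEdge x (from π j))
      ≡⟨ lookup∘tabulate (fA ∘ outEdge x) (from π j) ⟨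
    lookup (State.labels (d₀ x)) (from π j)
      ≡⟨ lookup∘tabulate (lookup (State.labels (d₀ x)) ∘ from π) j ⟨
    lookup (tabulate (lookup (State.labels (d₀ x)) ∘ from π)) j
      ∎
    where open ≡-Reasoning

  permuteOut-restricts : (c : outSize x ≡ outSize permuteOut) (j : Fin (outSize x)) →
                         outEdge permuteOut (cast c (to π j)) ≡ to (extend (isOut x) π) (outEdge x j)
  permuteOut-restricts c j = trans (outEdge-permuteOut c (to π j)) (sym (extend-enum (isOut x) π j))

lemma4p6 : (P : PetriNet) → D₀IsFibration P
lemma4p6 P x (state n labels) β with ↔⇒≡ (StateIso.bij β)
... | refl = permuteOut x π , final , permuteOut-iso x π , restricts
  where
  π : Fin (outSize x) ↔ Fin (outSize x)
  π = StateIso.bij β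

  final : d₀ (permuteOut x π) ≡ state (outSize x) labels
  final = trans (d₀-permuteOut x π)
                (cong (state _) (trans (tabulate-cong (sym ∘ lookup-from β)) (tabulate∘lookup labels)))

  restricts : RestrictsTo (permuteOut-iso x π) (subst (StateIso (d₀ x)) (sym final) β)
  restricts j = trans (cong (outEdge (permuteOut x π)) (to-subst-StateIso final β j))
                      (permuteOut-restricts x π (sym (cong State.size final)) j)
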